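{- Let $\pi$ be a simple permutation and let $p_1\neq p_2$ be two points in the plot of $\pi$, where $p_1$ is not the right-most point of the plot. Then there is a proper right-reaching pin sequence beginning with $p_1,p_2$.
   Context: The plot of a permutation $\pi$ of $[n]$ is the point set $\{(i,\pi(i)):i\in[n]\}$; its right-most point is $(n,\pi(n))$. An interval of $\pi$ is a set of contiguous indices $I$ with $\pi(I)$ a set of consecutive integers; $\pi$ is simple if its only intervals have size $0$, $1$ or $n$. For points $q_1,\dots,q_m$, $\operatorname{rect}(q_1,\dots,q_m)$ is the smallest closed axes-parallel rectangle containing them. A pin sequence is a sequence of distinct points $p_1,\dots,p_m$ of the plot such that for each $i\ge3$, writing $\operatorname{rect}(p_1,\dots,p_{i-1})=[a,b]\times[c,d]$ and $p_i=(x,y)$: $p_i\notin\operatorname{rect}(p_1,\dots,p_{i-1})$ and either $a<x<b$ or $c<y<d$. Such $p_i$ is a left pin if $x<a$, right pin if $x>b$, up pin if $y>d$, down pin if $y<c$. The pin sequence is proper if (maximality) each $p_i$, $i\ge3$, is extreme in its direction among all points of the plot that could serve as a pin of that direction for $\operatorname{rect}(p_1,\dots,p_{i-1})$ (e.g. for a right pin $p_i=(x,y)$ there is no point of the plot in $(x,n]\times[c,d]$), and (separation) for each $i\ge2$ with $i+1\le m$, $p_{i+1}$ lies horizontally or vertically strictly between $\operatorname{rect}(p_1,\dots,p_{i-1})$ and $p_i$. A pin sequence $p_1,\dots,p_m$ is right-reaching if $p_m$ is the right-most point of the plot of $\pi$. -}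

module Defs where

open import Data.Nat using (ℕ; zero; suc; _+_; _∸_; _≤_; _<_; _⊔_; _⊓_)
open import Data.Fin using (Fin; toℕ)
open import Data.Fin.Permutation using (Permutation′; _⟨$⟩ʳ_)
open import Data.List using (List; []; _∷_; _++_; map; length)
open import Data.List.Relation.Unary.Unique.Propositional using (Unique)
open import Data.Product using (Σ; ∃; _×_; _,_)
open import Data.Sum using (_⊎_)
open import Relation.Nullary using (¬_)
open import Relation.Binary.PropositionalEquality using (_≡_)

-- Coordinates are 0-based: the plot of π : Permutation′ n is
-- { (toℕ i , toℕ (π i)) : i : Fin n }.  (Shifting by 1 changes nothing.)

Point : Set
Point = ℕ × ℕ

xc : Point → ℕ
xc (x , _) = x

yc : Point → ℕ
yc (_ , y) = y

pt : ∀ {n} → Permutation′ n → Fin n → Point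
pt π i = (toℕ i , toℕ (π ⟨$⟩ʳ i))

IsInterval : ∀ {n} → Permutation′ n → ℕ → ℕ → Set
IsInterval {n} π a b =
  Σ ℕ λ c → (y : Fin n) →
    ((Σ (Fin n) λ i → (a ≤ toℕ i × toℕ i ≤ b) × π ⟨$⟩ʳ i ≡ y) → (c ≤ toℕ y × toℕ y ≤ c + (b ∸ a)))
    × ((c ≤ toℕ y × toℕ y ≤ c + (b ∸ a)) → (Σ (Fin n) λ i → (a ≤ toℕ i × toℕ i ≤ b) × π ⟨$⟩ʳ i ≡ y))

Simple : ∀ {n} → Permutation′ n → Set
Simple {n} π = (a b : ℕ) → a ≤ b → b < n → IsInterval π a b →
  (a ≡ b) ⊎ (a ≡ 0 × suc b ≡ n)

record Rect : Set where
  constructor rect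
  field
    ra rb rc rd : ℕ
open Rect public

-- smallest rectangle containing a (nonempty) list of points
-- (the value on [] is irrelevant: it is only used on nonempty lists)
box : List Point → Rect
box [] = rect 0 0 0 0
box ((x , y) ∷ []) = rect x x y y
box ((x , y) ∷ ps@(_ ∷ _)) with box ps
... | rect a b c d = rect (x ⊓ a) (x ⊔ b) (y ⊓ c) (y ⊔ d)

InRect : Rect → Point → Set
InRect (rect a b c d) (x , y) = (a ≤ x × x ≤ b) × (c ≤ y × y ≤ d)

PinFor : Rect → Point → Set
PinFor R@(rect a b c d) p@(x , y) = ¬ InRect R p × ((a < x × x < b) ⊎ (c < y × y < d))

Maximal : ∀ {n} → Permutation′ n → Rect → Point → Set
Maximal {n} π (rect a b c d) (x , y) =
    (b < x → (j : Fin n) → ¬ (x < xc (pt π j) × (c ≤ yc (pt π j) × yc (pt π j) ≤ d)))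
  × (x < a → (j : Fin n) → ¬ (xc (pt π j) < x × (c ≤ yc (pt π j) × yc (pt π j) ≤ d)))
  × (d < y → (j : Fin n) → ¬ (y < yc (pt π j) × (a ≤ xc (pt π j) × xc (pt π j) ≤ b)))
  × (y < c → (j : Fin n) → ¬ (yc (pt π j) < y × (a ≤ xc (pt π j) × xc (pt π j) ≤ b)))

StrictlyBetween : Rect → Point → Point → Set
StrictlyBetween (rect a b c d) (x , y) (x' , y') =
    (b < x' × x' < x) ⊎ (x < x' × x' < a) ⊎ (d < y' × y' < y) ⊎ (y < y' × y' < c)

PinSequence : ∀ {n} → Permutation′ n → List (Fin n) → Set
PinSequence π ps =
    Unique ps
  × ((pre : List Point) (p : Point) (post : List Point) →
       map (pt π) ps ≡ pre ++ p ∷ post → 2 ≤ length pre → PinFor (box pre) p)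

ProperPinSequence : ∀ {n} → Permutation′ n → List (Fin n) → Set
ProperPinSequence π ps =
    PinSequence π ps
  × ((pre : List Point) (p : Point) (post : List Point) →
       map (pt π) ps ≡ pre ++ p ∷ post → 2 ≤ length pre → Maximal π (box pre) p)
  × ((pre : List Point) (p q : Point) (post : List Point) →
       map (pt π) ps ≡ pre ++ p ∷ q ∷ post → 1 ≤ length pre → StrictlyBetween (box pre) p q)

RightReaching : ∀ {n} → Permutation′ n → List (Fin n) → Set
RightReaching {n} π ps = Σ (List (Fin n)) λ pre → Σ (Fin n) λ r → ps ≡ pre ++ r ∷ [] × suc (toℕ r) ≡ n

-- Grow proper pin sequences starting p₁, p₂ and keep the frame, the smallest rectangle
-- containing all their boxes, such that every row and column of the frame is spanned by one
-- of the boxes.  If a point lies in the columns of the frame but above it (or symmetrically),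
-- take a sequence whose box spans its column and cut it at its shortest prefix whose box's
-- columns contain a point above the frame.  The highest point in those columns is a proper
-- pin for that prefix, separated from the earlier points by the last one, whose addition
-- widened the columns.  Appending it strictly enlarges the frame, which can happen fewer
-- than 2n times, so eventually no point escapes the frame.
-- Then π maps the columns of the frame onto its rows, an interval of size at least 2, so by
-- simplicity the frame is the whole square and some sequence reaches the right-most point,
-- which is not p₁; the prefix ending there is the required sequence.

module Submission where

open import Defs
open import Data.Nat using (ℕ; zero; suc; _+_; _∸_; _≤_; _<_; _⊔_; _⊓_; s≤s; s≤s⁻¹; _≤?_; _<?_)
open import Data.Nat.Properties
open import Data.Fin using (Fin; toℕ; fromℕ<)
open import Data.Fin.Properties using (toℕ-injective; toℕ<n; toℕ-fromℕ<; any?; injective⇒≤)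
open import Data.Fin.Permutation using (Permutation′; _⟨$⟩ʳ_; _⟨$⟩ˡ_; inverseʳ; flip)
open import Data.List using (List; []; _∷_; _++_; length; _∷ʳ_; [_]; map; filter; allFin; initLast; _∷ʳ′_)
open import Data.List.Properties using (map-++; ++-assoc; ∷ʳ-injective)
open import Data.List.Membership.Propositional using (_∈_; _∉_; find)
open import Data.List.Membership.Propositional.Properties using (∈-∃++; ∈-filter⁺; ∈-allFin)
open import Data.List.Relation.Unary.All as All using (All; []; _∷_)
import Data.List.Relation.Unary.All.Properties as All
open import Data.List.Relation.Unary.Any as Any using (Any; here; there)
import Data.List.Relation.Unary.Any.Properties as Any
open import Data.List.Relation.Unary.AllPairs using ([]; _∷_)
open import Data.List.Relation.Unary.Unique.Propositional using (Unique)
import Data.List.Relation.Unary.Unique.Propositional.Properties as Unique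
open import Data.Product using (Σ; ∃; ∃₂; _×_; _,_; proj₁; proj₂)
open import Data.Sum as Sum using (_⊎_; inj₁; inj₂)
open import Data.Empty using (⊥-elim)
open import Function using (_∘_; case_of_; Injective)
open import Function.Bundles using (Injection)
open import Function.Properties.Inverse using (↔⇒↣)
open import Algebra.Definitions using (Selective)
open import Algebra.Core using (Op₂)
open import Relation.Unary using (Decidable)
open import Relation.Binary.Bundles using (TotalOrder)
open import Relation.Binary.Definitions using (tri<; tri≈; tri>)
import Relation.Binary.Construct.Flip.EqAndOrd as Flip
import Data.List.Extrema as Extrema
open import Level using (0ℓ)
open import Relation.Nullary using (¬_; Dec; yes; no)
open import Relation.Nullary.Decidable using (_×-dec_)
open import Relation.Binary.PropositionalEquality
  using (_≡_; _≢_; refl; sym; trans; cong; cong₂; subst; module ≡-Reasoning)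

_∈[_,_] : ℕ → ℕ → ℕ → Set
v ∈[ a , b ] = a ≤ v × v ≤ b

∈-hull : ∀ {a b a′ b′ t v} → t ∈[ a , b ] → t ∈[ a′ , b′ ] → v ∈[ a ⊓ a′ , b ⊔ b′ ] →
         v ∈[ a , b ] ⊎ v ∈[ a′ , b′ ]
∈-hull {a} {b} {a′} {b′} {t} {v} (a≤t , t≤b) (a′≤t , t≤b′) (lo , hi) with v ≤? t | a ≤? v | v ≤? b
... | yes v≤t | yes a≤v | _     = inj₁ (a≤v , ≤-trans v≤t t≤b)
... | yes v≤t | no a≰v  | _     = inj₂ (≮⇒≥ (λ v<a′ → <⇒≱ (⊓-glb (≰⇒> a≰v) v<a′) lo) , ≤-trans v≤t t≤b′)
... | no v≰t  | _       | yes v≤b = inj₁ (≤-trans a≤t (<⇒≤ (≰⇒> v≰t)) , v≤b)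
... | no v≰t  | _       | no v≰b  =
  inj₂ (≤-trans a′≤t (<⇒≤ (≰⇒> v≰t)) , ≮⇒≥ (λ b′<v → <⇒≱ (⊔-lub (≰⇒> v≰b) b′<v) hi))

between-interval-point : ∀ {a b x v} → a ⊓ x < v → v < b ⊔ x → ¬ v ∈[ a , b ] →
            (b < v × v < x) ⊎ (x < v × v < a)
between-interval-point {a} lo hi v∉ with a ≤? _
... | yes a≤v = inj₁ (b<v , ≰⇒> (λ x≤v → <⇒≱ hi (⊔-lub (<⇒≤ b<v) x≤v)))
  where b<v = ≰⇒> (λ v≤b → v∉ (a≤v , v≤b))
... | no a≰v = inj₂ (≰⇒> (λ v≤x → <⇒≱ lo (⊓-glb (<⇒≤ (≰⇒> a≰v)) v≤x)) , ≰⇒> a≰v)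

∸-grows-hi : ∀ {a b a′ b′} → a ≤ b → a′ ≤ a → b < b′ → b ∸ a < b′ ∸ a′
∸-grows-hi {b′ = b′} a≤b a′≤a b<b′ = <-≤-trans (∸-monoˡ-< b<b′ a≤b) (∸-monoʳ-≤ b′ a′≤a)

∸-grows-lo : ∀ {a b a′ b′} → a ≤ b → a′ < a → b ≤ b′ → b ∸ a < b′ ∸ a′
∸-grows-lo {a′ = a′} a≤b a′<a b≤b′ = <-≤-trans (∸-monoʳ-< a′<a a≤b) (∸-monoˡ-≤ a′ b≤b′)

module _ {A : Set} where

  shortest-prefix : ∀ {Q : List A → Set} → Decidable Q → ∀ ys → ¬ Q [] → Q ys →
                    ∃₂ λ mid z → ∃ λ post → ys ≡ mid ++ z ∷ post × ¬ Q mid × Q (mid ∷ʳ z)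
  shortest-prefix Q? [] ¬q[] q = ⊥-elim (¬q[] q)
  shortest-prefix Q? (y ∷ ys) ¬q[] q with Q? [ y ]
  ... | yes q[y] = [] , y , ys , refl , ¬q[] , q[y]
  ... | no ¬q[y] with shortest-prefix (Q? ∘ (y ∷_)) ys ¬q[y] q
  ...   | mid , z , post , refl , ¬q[mid] , q[mid∷ʳz] = y ∷ mid , z , post , refl , ¬q[mid] , q[mid∷ʳz]

  ∷ʳ-≡-++-∷ : ∀ (xs : List A) {y} pre {p} post → xs ∷ʳ y ≡ pre ++ p ∷ post →
              (∃ λ post′ → xs ≡ pre ++ p ∷ post′ × post ≡ post′ ∷ʳ y) ⊎ (xs ≡ pre × p ≡ y × post ≡ [])
  ∷ʳ-≡-++-∷ xs pre post eq with initLast post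
  ... | [] with ∷ʳ-injective xs pre eq
  ...   | xs≡pre , y≡p = inj₂ (xs≡pre , sym y≡p , refl)
  ∷ʳ-≡-++-∷ xs pre {p} post eq | post′ ∷ʳ′ w
    with ∷ʳ-injective xs (pre ++ p ∷ post′) (trans eq (sym (++-assoc pre (p ∷ post′) [ w ])))
  ... | xs≡ , refl = inj₁ (post′ , xs≡ , refl)

  ∷ʳ-head : ∀ {x : A} {xs} ys {z} zs → x ∷ xs ≡ ys ++ z ∷ zs → ∃ λ xs′ → ys ∷ʳ z ≡ x ∷ xs′
  ∷ʳ-head []       zs refl = [] , refl
  ∷ʳ-head (y ∷ ys) {z} zs refl = ys ∷ʳ z , refl

  Unique-++⁻ˡ : ∀ (xs : List A) {ys} → Unique (xs ++ ys) → Unique xs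
  Unique-++⁻ˡ []       _            = []
  Unique-++⁻ˡ (x ∷ xs) (x∉ ∷ uniq) = All.++⁻ˡ xs x∉ ∷ Unique-++⁻ˡ xs uniq

  Unique-∷ʳ : ∀ {xs} {x : A} → Unique xs → x ∉ xs → Unique (xs ∷ʳ x)
  Unique-∷ʳ uniq x∉ = Unique.++⁺ uniq ([] ∷ []) λ { (x∈ , here refl) → x∉ x∈ }

argmax-exists : ∀ {n} (O : TotalOrder 0ℓ 0ℓ 0ℓ) (f : Fin n → TotalOrder.Carrier O) {Q : Fin n → Set} →
                Decidable Q → ∀ {j} → Q j → ∃ λ q → Q q × ∀ i → Q i → TotalOrder._≤_ O (f i) (f q)
argmax-exists O f Q? {j} qj =
  q , argmax-all f qj (All.all-filter Q? (allFin _)) ,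
  λ i qi → All.lookup (f[xs]≤f[argmax] j candidates) (∈-filter⁺ Q? (∈-allFin i) qi)
  where
  open Extrema O
  candidates = filter Q? (allFin _)
  q = argmax f j candidates

injection-span : ∀ {n} (f : Fin n → Fin n) → Injective _≡_ _≡_ f → ∀ {a b c d} → a ≤ b → b < n →
                 (∀ i → toℕ i ∈[ a , b ] → toℕ (f i) ∈[ c , d ]) → b ∸ a ≤ d ∸ c
injection-span {n} f f-injective {a} {b} {c} {d} a≤b b<n f-maps = s≤s⁻¹ (injective⇒≤ g-injective)
  where
  a+k≤b : (k : Fin (suc (b ∸ a))) → a + toℕ k ≤ b
  a+k≤b k = ≤-trans (+-monoʳ-≤ a (s≤s⁻¹ (toℕ<n k))) (≤-reflexive (m+[n∸m]≡n a≤b))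

  column : Fin (suc (b ∸ a)) → Fin n
  column k = fromℕ< (≤-<-trans (a+k≤b k) b<n)

  column∈ : ∀ k → toℕ (column k) ∈[ a , b ]
  column∈ k rewrite toℕ-fromℕ< (≤-<-trans (a+k≤b k) b<n) = m≤m+n a (toℕ k) , a+k≤b k

  row∈ : ∀ k → toℕ (f (column k)) ∈[ c , d ]
  row∈ k = f-maps (column k) (column∈ k)

  g : Fin (suc (b ∸ a)) → Fin (suc (d ∸ c))
  g k = fromℕ< (s≤s (∸-monoˡ-≤ c (proj₂ (row∈ k))))

  g-injective : Injective _≡_ _≡_ g
  g-injective {k} {k′} gk≡gk′ = toℕ-injective (+-cancelˡ-≡ a _ _ (begin
    a + toℕ k       ≡⟨ toℕ-fromℕ< _ ⟨
    toℕ (column k)  ≡⟨ cong toℕ (f-injective (toℕ-injective rows≡)) ⟩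
    toℕ (column k′) ≡⟨ toℕ-fromℕ< _ ⟩
    a + toℕ k′      ∎))
    where
    open ≡-Reasoning
    rows≡ : toℕ (f (column k)) ≡ toℕ (f (column k′))
    rows≡ = ∸-cancelʳ-≡ (proj₁ (row∈ k)) (proj₁ (row∈ k′))
              (trans (sym (toℕ-fromℕ< _)) (trans (cong toℕ gk≡gk′) (toℕ-fromℕ< _)))

-- Rectangles

point : Point → Rect
point (x , y) = rect x x y y

infixl 6 _⊔ᴿ_
_⊔ᴿ_ : Rect → Rect → Rect
R ⊔ᴿ S = rect (ra R ⊓ ra S) (rb R ⊔ rb S) (rc R ⊓ rc S) (rd R ⊔ rd S)

infix 4 _⊆ᴿ_
_⊆ᴿ_ : Rect → Rect → Set
R ⊆ᴿ S = ra S ≤ ra R × rb R ≤ rb S × rc S ≤ rc R × rd R ≤ rd S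

⊆ᴿ-refl : ∀ {R} → R ⊆ᴿ R
⊆ᴿ-refl = ≤-refl , ≤-refl , ≤-refl , ≤-refl

⊆ᴿ-trans : ∀ {R S T} → R ⊆ᴿ S → S ⊆ᴿ T → R ⊆ᴿ T
⊆ᴿ-trans (a , b , c , d) (a′ , b′ , c′ , d′) = ≤-trans a′ a , ≤-trans b b′ , ≤-trans c′ c , ≤-trans d d′

⊆ᴿ-⊔ᴿˡ : ∀ R S → R ⊆ᴿ R ⊔ᴿ S
⊆ᴿ-⊔ᴿˡ R S = m⊓n≤m _ _ , m≤m⊔n _ _ , m⊓n≤m _ _ , m≤m⊔n _ _

⊆ᴿ-⊔ᴿʳ : ∀ R S → S ⊆ᴿ R ⊔ᴿ S
⊆ᴿ-⊔ᴿʳ R S = m⊓n≤n _ _ , m≤n⊔m _ _ , m⊓n≤n _ _ , m≤n⊔m _ _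

InRect-⊆ᴿ : ∀ {R S p} → R ⊆ᴿ S → InRect R p → InRect S p
InRect-⊆ᴿ (a , b , c , d) ((a≤ , ≤b) , (c≤ , ≤d)) =
  (≤-trans a a≤ , ≤-trans ≤b b) , (≤-trans c c≤ , ≤-trans ≤d d)

⊔ᴿ-assoc : ∀ R S T → (R ⊔ᴿ S) ⊔ᴿ T ≡ R ⊔ᴿ (S ⊔ᴿ T)
⊔ᴿ-assoc R S T = cong₂ (λ (a , b) (c , d) → rect a b c d)
  (cong₂ _,_ (⊓-assoc (ra R) _ _) (⊔-assoc (rb R) _ _)) (cong₂ _,_ (⊓-assoc (rc R) _ _) (⊔-assoc (rd R) _ _))

box-cons : ∀ p q ps → box (p ∷ q ∷ ps) ≡ point p ⊔ᴿ box (q ∷ ps)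
box-cons p q ps with box (q ∷ ps)
... | rect a b c d = refl

box-∷ʳ : ∀ p ps q → box (p ∷ ps ∷ʳ q) ≡ box (p ∷ ps) ⊔ᴿ point q
box-∷ʳ p []        q = refl
box-∷ʳ p (p′ ∷ ps) q = begin
  box (p ∷ p′ ∷ ps ∷ʳ q)               ≡⟨ box-cons p p′ (ps ∷ʳ q) ⟩
  point p ⊔ᴿ box (p′ ∷ ps ∷ʳ q)        ≡⟨ cong (point p ⊔ᴿ_) (box-∷ʳ p′ ps q) ⟩
  point p ⊔ᴿ (box (p′ ∷ ps) ⊔ᴿ point q) ≡⟨ ⊔ᴿ-assoc (point p) _ _ ⟨
  point p ⊔ᴿ box (p′ ∷ ps) ⊔ᴿ point q   ≡⟨ cong (_⊔ᴿ point q) (box-cons p p′ ps) ⟨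
  box (p ∷ p′ ∷ ps) ⊔ᴿ point q          ∎
  where open ≡-Reasoning

∈-point : ∀ p → InRect (point p) p
∈-point p = (≤-refl , ≤-refl) , (≤-refl , ≤-refl)

∈-box : ∀ p ps → All (InRect (box (p ∷ ps))) (p ∷ ps)
∈-box p [] = ∈-point p ∷ []
∈-box p (q ∷ ps) rewrite box-cons p q ps =
  InRect-⊆ᴿ (⊆ᴿ-⊔ᴿˡ (point p) _) (∈-point p) ∷
  All.map (InRect-⊆ᴿ (⊆ᴿ-⊔ᴿʳ (point p) _)) (∈-box q ps)

box-least : ∀ {R} p ps → All (InRect R) (p ∷ ps) → box (p ∷ ps) ⊆ᴿ R
box-least p [] (((a≤ , ≤b) , (c≤ , ≤d)) ∷ []) = a≤ , ≤b , c≤ , ≤d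
box-least p (q ∷ ps) (((a≤ , ≤b) , (c≤ , ≤d)) ∷ qs) rewrite box-cons p q ps
  with box-least q ps qs
... | a , b , c , d = ⊓-glb a≤ a , ⊔-lub ≤b b , ⊓-glb c≤ c , ⊔-lub ≤d d

data Axis : Set where
  horizontal vertical : Axis

coord : Axis → Point → ℕ
coord horizontal = xc
coord vertical   = yc

lo hi : Axis → Rect → ℕ
lo horizontal = ra
lo vertical   = rc
hi horizontal = rb
hi vertical   = rd

Spans : Axis → Rect → ℕ → Set
Spans a R v = v ∈[ lo a R , hi a R ]

SpansStrictly : Axis → Rect → ℕ → Set
SpansStrictly a R v = lo a R < v × v < hi a R

Spans? : ∀ a R v → Dec (Spans a R v)
Spans? a R v = (lo a R ≤? v) ×-dec (v ≤? hi a R)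

InRect⇒Spans : ∀ a {R p} → InRect R p → Spans a R (coord a p)
InRect⇒Spans horizontal = proj₁
InRect⇒Spans vertical   = proj₂

lo≤hi : ∀ a {R p} → InRect R p → lo a R ≤ hi a R
lo≤hi a p∈R = let lo≤ , ≤hi = InRect⇒Spans a p∈R in ≤-trans lo≤ ≤hi

hi-⊆ᴿ : ∀ a {R S} → R ⊆ᴿ S → hi a R ≤ hi a S
hi-⊆ᴿ horizontal = proj₁ ∘ proj₂
hi-⊆ᴿ vertical   = proj₂ ∘ proj₂ ∘ proj₂

Spans-point : ∀ a {p v} → Spans a (point p) v → v ≡ coord a p
Spans-point horizontal (lo≤ , ≤hi) = ≤-antisym ≤hi lo≤
Spans-point vertical   (lo≤ , ≤hi) = ≤-antisym ≤hi lo≤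

lo<hi : ∀ a {R p q} → InRect R p → InRect R q → coord a p ≢ coord a q → lo a R < hi a R
lo<hi a {p = p} {q} p∈R q∈R p≢q with InRect⇒Spans a p∈R | InRect⇒Spans a q∈R | <-cmp (coord a p) (coord a q)
... | lo≤p , _ | _ , q≤hi | tri< p<q _ _ = ≤-<-trans lo≤p (<-≤-trans p<q q≤hi)
... | _ | _ | tri≈ _ p≡q _ = ⊥-elim (p≢q p≡q)
... | _ , p≤hi | lo≤q , _ | tri> _ _ q<p = ≤-<-trans lo≤q (<-≤-trans q<p p≤hi)

Spans-⊔ᴿ : ∀ a {R S t v} → Spans a R t → Spans a S t → Spans a (R ⊔ᴿ S) v → Spans a R v ⊎ Spans a S v
Spans-⊔ᴿ horizontal = ∈-hull
Spans-⊔ᴿ vertical   = ∈-hull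

extent : Axis → Rect → ℕ
extent a R = hi a R ∸ lo a R

extent-⊔ᴿ : ∀ a R S → extent a R ≤ extent a (R ⊔ᴿ S)
extent-⊔ᴿ horizontal R S = ∸-mono (m≤m⊔n (rb R) _) (m⊓n≤m (ra R) _)
extent-⊔ᴿ vertical   R S = ∸-mono (m≤m⊔n (rd R) _) (m⊓n≤m (rc R) _)

size : Rect → ℕ
size R = extent horizontal R + extent vertical R

private
  attained : (edge : Rect → ℕ) (f : Point → ℕ) {_∙_ : Op₂ ℕ} → Selective _≡_ _∙_ →
             (∀ p R → edge (point p ⊔ᴿ R) ≡ f p ∙ edge R) → (∀ p → edge (point p) ≡ f p) →
             ∀ p ps → Any (λ e → f e ≡ edge (box (p ∷ ps))) (p ∷ ps)
  attained edge f sel cons single p [] = here (sym (single p))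
  attained edge f {_∙_} sel cons single p (q ∷ ps) =
    Any.map (λ e → trans e (sym (trans (cong edge (box-cons p q ps)) (cons p _)))) selected
    where
    selected : Any (λ e → f e ≡ f p ∙ edge (box (q ∷ ps))) (p ∷ q ∷ ps)
    selected with sel (f p) (edge (box (q ∷ ps)))
    ... | inj₁ e = here (sym e)
    ... | inj₂ e = there (Any.map (λ h → trans h (sym e)) (attained edge f sel cons single q ps))

box-lo-attained : ∀ a p ps → Any (λ e → coord a e ≡ lo a (box (p ∷ ps))) (p ∷ ps)
box-lo-attained horizontal = attained ra xc ⊓-sel (λ _ _ → refl) (λ _ → refl)
box-lo-attained vertical   = attained rc yc ⊓-sel (λ _ _ → refl) (λ _ → refl)

box-hi-attained : ∀ a p ps → Any (λ e → coord a e ≡ hi a (box (p ∷ ps))) (p ∷ ps)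
box-hi-attained horizontal = attained rb xc ⊔-sel (λ _ _ → refl) (λ _ → refl)
box-hi-attained vertical   = attained rd yc ⊔-sel (λ _ _ → refl) (λ _ → refl)

StrictlyBetween-⊔ᴿ-point : ∀ a {R z q} → SpansStrictly a (R ⊔ᴿ point z) (coord a q) → ¬ Spans a R (coord a q) →
                 StrictlyBetween R z q
StrictlyBetween-⊔ᴿ-point horizontal (lo< , <hi) q∉ = Sum.map₂ inj₁ (between-interval-point lo< <hi q∉)
StrictlyBetween-⊔ᴿ-point vertical   (lo< , <hi) q∉ = inj₂ (inj₂ (between-interval-point lo< <hi q∉))

-- Pin directions

data Dir : Set where
  up down left right : Dir

across : Dir → Axis
across up    = horizontal
across down  = horizontal
across left  = vertical
across right = vertical

-- The lane of R in direction d: its columns for up and down pins, its rows for left and right ones.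
InLane : Dir → Rect → Point → Set
InLane d R p = Spans (across d) R (coord (across d) p)

InLane? : ∀ d R p → Dec (InLane d R p)
InLane? d R p = Spans? (across d) R (coord (across d) p)

Beyond : Dir → Rect → Point → Set
Beyond up    R p = rd R < yc p
Beyond down  R p = yc p < rc R
Beyond left  R p = xc p < ra R
Beyond right R p = rb R < xc p

Beyond? : ∀ d R p → Dec (Beyond d R p)
Beyond? up    R p = _ <? _
Beyond? down  R p = _ <? _
Beyond? left  R p = _ <? _
Beyond? right R p = _ <? _

Ahead : Dir → Point → Point → Set
Ahead up    p p′ = yc p < yc p′
Ahead down  p p′ = yc p′ < yc p
Ahead left  p p′ = xc p′ < xc p
Ahead right p p′ = xc p < xc p′

any-Dir? : {Q : Dir → Set} → (∀ d → Dec (Q d)) → Dec (∃ Q)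
any-Dir? Q? with Q? up | Q? down | Q? left | Q? right
... | yes q | _     | _     | _     = yes (up , q)
... | no _  | yes q | _     | _     = yes (down , q)
... | no _  | no _  | yes q | _     = yes (left , q)
... | no _  | no _  | no _  | yes q = yes (right , q)
... | no ¬u | no ¬d | no ¬l | no ¬r =
  no λ { (up , q) → ¬u q ; (down , q) → ¬d q ; (left , q) → ¬l q ; (right , q) → ¬r q }

Beyond⇒∉ : ∀ d {R p} → Beyond d R p → ¬ InRect R p
Beyond⇒∉ up    d<y (_ , (_ , y≤d)) = <⇒≱ d<y y≤d
Beyond⇒∉ down  y<c (_ , (c≤y , _)) = <⇒≱ y<c c≤y
Beyond⇒∉ left  x<a ((a≤x , _) , _) = <⇒≱ x<a a≤x
Beyond⇒∉ right b<x ((_ , x≤b) , _) = <⇒≱ b<x x≤b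

Beyond-⊆ᴿ : ∀ d {R S p} → S ⊆ᴿ R → Beyond d R p → Beyond d S p
Beyond-⊆ᴿ up    (_ , _ , _ , d) = ≤-<-trans d
Beyond-⊆ᴿ down  (_ , _ , c , _) y<c = <-≤-trans y<c c
Beyond-⊆ᴿ left  (a , _ , _ , _) x<a = <-≤-trans x<a a
Beyond-⊆ᴿ right (_ , b , _ , _) = ≤-<-trans b

Beyond-¬Ahead : ∀ d {R p p′} → Beyond d R p → ¬ Ahead d p′ p → Beyond d R p′
Beyond-¬Ahead up    d<y ¬ahead = <-≤-trans d<y (≮⇒≥ ¬ahead)
Beyond-¬Ahead down  y<c ¬ahead = ≤-<-trans (≮⇒≥ ¬ahead) y<c
Beyond-¬Ahead left  x<a ¬ahead = ≤-<-trans (≮⇒≥ ¬ahead) x<a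
Beyond-¬Ahead right b<x ¬ahead = <-≤-trans b<x (≮⇒≥ ¬ahead)

Beyond⇒PinFor : ∀ d {R p} → SpansStrictly (across d) R (coord (across d) p) → Beyond d R p → PinFor R p
Beyond⇒PinFor up    inside beyond = Beyond⇒∉ up beyond , inj₁ inside
Beyond⇒PinFor down  inside beyond = Beyond⇒∉ down beyond , inj₁ inside
Beyond⇒PinFor left  inside beyond = Beyond⇒∉ left beyond , inj₂ inside
Beyond⇒PinFor right inside beyond = Beyond⇒∉ right beyond , inj₂ inside

size-⊔ᴿ-grows : ∀ d {R S o p} → InRect R o → InRect S p → Beyond d R p → size R < size (R ⊔ᴿ S)
size-⊔ᴿ-grows up {R} {S} o∈R (_ , (_ , y≤d)) d<y = +-mono-≤-< (extent-⊔ᴿ horizontal R S)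
  (∸-grows-hi (lo≤hi vertical o∈R) (m⊓n≤m (rc R) _) (<-≤-trans d<y (≤-trans y≤d (m≤n⊔m (rd R) _))))
size-⊔ᴿ-grows down {R} {S} o∈R (_ , (c≤y , _)) y<c = +-mono-≤-< (extent-⊔ᴿ horizontal R S)
  (∸-grows-lo (lo≤hi vertical o∈R) (≤-<-trans (m⊓n≤n (rc R) _) (≤-<-trans c≤y y<c)) (m≤m⊔n (rd R) _))
size-⊔ᴿ-grows left {R} {S} o∈R ((a≤x , _) , _) x<a = +-mono-<-≤
  (∸-grows-lo (lo≤hi horizontal o∈R) (≤-<-trans (m⊓n≤n (ra R) _) (≤-<-trans a≤x x<a)) (m≤m⊔n (rb R) _))
  (extent-⊔ᴿ vertical R S)
size-⊔ᴿ-grows right {R} {S} o∈R ((_ , x≤b) , _) b<x = +-mono-<-≤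
  (∸-grows-hi (lo≤hi horizontal o∈R) (m⊓n≤m (ra R) _) (<-≤-trans b<x (≤-trans x≤b (m≤n⊔m (rb R) _))))
  (extent-⊔ᴿ vertical R S)

-- Proper pin sequences of a fixed permutation

module PinSequences {n} (π : Permutation′ n) where

  P : Fin n → Point
  P = pt π

  B : List (Fin n) → Rect
  B = box ∘ map P

  Proper : List (Fin n) → Set
  Proper = ProperPinSequence π

  Extreme : Dir → Rect → Point → Set
  Extreme d R p = (j : Fin n) → ¬ (Ahead d p (P j) × InLane d R (P j))

  coord-injective : ∀ a {i j} → coord a (P i) ≡ coord a (P j) → i ≡ j
  coord-injective horizontal = toℕ-injective
  coord-injective vertical   = Injection.injective (↔⇒↣ π) ∘ toℕ-injective

  coord<n : ∀ a i → coord a (P i) < n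
  coord<n horizontal i = toℕ<n i
  coord<n vertical   i = toℕ<n (π ⟨$⟩ʳ i)

  ∈-B : ∀ x l → All (λ i → InRect (B (x ∷ l)) (P i)) (x ∷ l)
  ∈-B x l = All.map⁻ (∈-box (P x) (map P l))

  B-++ : ∀ x l m → B (x ∷ l) ⊆ᴿ B (x ∷ l ++ m)
  B-++ x l m = box-least (P x) (map P l) (All.map⁺ (All.++⁻ˡ (x ∷ l) (∈-B x (l ++ m))))

  B-∷ʳ : ∀ x l z → B (x ∷ l ∷ʳ z) ≡ B (x ∷ l) ⊔ᴿ point (P z)
  B-∷ʳ x l z = trans (cong (box ∘ (P x ∷_)) (map-++ P l [ z ])) (box-∷ʳ (P x) (map P l) (P z))

  B-hi-attained : ∀ a x l → Any (λ i → coord a (P i) ≡ hi a (B (x ∷ l))) (x ∷ l)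
  B-hi-attained a x l = Any.map⁻ (box-hi-attained a (P x) (map P l))

  B-lo-attained : ∀ a x l → Any (λ i → coord a (P i) ≡ lo a (B (x ∷ l))) (x ∷ l)
  B-lo-attained a x l = Any.map⁻ (box-lo-attained a (P x) (map P l))

  ∈-B-last : ∀ x l q → InRect (B (x ∷ l ∷ʳ q)) (P q)
  ∈-B-last x l q = All.head (All.++⁻ʳ (x ∷ l) (∈-B x (l ∷ʳ q)))

  hi-B<n : ∀ a x l → hi a (B (x ∷ l)) < n
  hi-B<n a x l = let i , e = Any.satisfied (B-hi-attained a x l) in subst (_< n) e (coord<n a i)

  Spans⇒SpansStrictly : ∀ a x l {q} → q ∉ x ∷ l → Spans a (B (x ∷ l)) (coord a (P q)) →
                        SpansStrictly a (B (x ∷ l)) (coord a (P q))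
  Spans⇒SpansStrictly a x l q∉ (lo≤ , ≤hi) =
    ≤∧≢⇒< lo≤ (λ lo≡ → q∉ (attained-by (B-lo-attained a x l) (sym lo≡))) ,
    ≤∧≢⇒< ≤hi (λ ≡hi → q∉ (attained-by (B-hi-attained a x l) ≡hi))
    where
    attained-by : ∀ {l e q} → Any (λ i → coord a (P i) ≡ e) l → coord a (P q) ≡ e → q ∈ l
    attained-by attained q≡ = Any.map (λ i≡ → coord-injective a (trans q≡ (sym i≡))) attained

  Beyond⇒Maximal : ∀ d {R o p} → InRect R o → InLane d R p → Beyond d R p → Extreme d R p → Maximal π R p
  Beyond⇒Maximal up o∈R (a≤x , x≤b) d<y extreme =
    (λ b<x → ⊥-elim (<⇒≱ b<x x≤b)) , (λ x<a → ⊥-elim (<⇒≱ x<a a≤x)) , (λ _ → extreme) ,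
    (λ y<c → ⊥-elim (<⇒≱ y<c (≤-trans (lo≤hi vertical o∈R) (<⇒≤ d<y))))
  Beyond⇒Maximal down o∈R (a≤x , x≤b) y<c extreme =
    (λ b<x → ⊥-elim (<⇒≱ b<x x≤b)) , (λ x<a → ⊥-elim (<⇒≱ x<a a≤x)) ,
    (λ d<y → ⊥-elim (<⇒≱ y<c (≤-trans (lo≤hi vertical o∈R) (<⇒≤ d<y)))) , (λ _ → extreme)
  Beyond⇒Maximal left o∈R (c≤y , y≤d) x<a extreme =
    (λ b<x → ⊥-elim (<⇒≱ x<a (≤-trans (lo≤hi horizontal o∈R) (<⇒≤ b<x)))) , (λ _ → extreme) ,
    (λ d<y → ⊥-elim (<⇒≱ d<y y≤d)) , (λ y<c → ⊥-elim (<⇒≱ y<c c≤y))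
  Beyond⇒Maximal right o∈R (c≤y , y≤d) b<x extreme =
    (λ _ → extreme) , (λ x<a → ⊥-elim (<⇒≱ x<a (≤-trans (lo≤hi horizontal o∈R) (<⇒≤ b<x)))) ,
    (λ d<y → ⊥-elim (<⇒≱ d<y y≤d)) , (λ y<c → ⊥-elim (<⇒≱ y<c c≤y))

  extreme : ∀ d R {j} → InLane d R (P j) → ∃ λ q → InLane d R (P q) × Extreme d R (P q)
  extreme up R j∈ with argmax-exists ≤-totalOrder (yc ∘ P) (InLane? up R ∘ P) j∈
  ... | q , q∈ , best = q , q∈ , λ i (ahead , i∈) → <⇒≱ ahead (best i i∈)
  extreme down R j∈ with argmax-exists (Flip.totalOrder ≤-totalOrder) (yc ∘ P) (InLane? down R ∘ P) j∈
  ... | q , q∈ , best = q , q∈ , λ i (ahead , i∈) → <⇒≱ ahead (best i i∈)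
  extreme left R j∈ with argmax-exists (Flip.totalOrder ≤-totalOrder) (xc ∘ P) (InLane? left R ∘ P) j∈
  ... | q , q∈ , best = q , q∈ , λ i (ahead , i∈) → <⇒≱ ahead (best i i∈)
  extreme right R j∈ with argmax-exists ≤-totalOrder (xc ∘ P) (InLane? right R ∘ P) j∈
  ... | q , q∈ , best = q , q∈ , λ i (ahead , i∈) → <⇒≱ ahead (best i i∈)

  proper-++⁻ˡ : ∀ l {m} → Proper (l ++ m) → Proper l
  proper-++⁻ˡ l {m} ((uniq , pins) , maximal , separated) =
    (Unique-++⁻ˡ l uniq , λ pre p _ → pins pre p _ ∘ grow) ,
    (λ pre p _ → maximal pre p _ ∘ grow) ,
    (λ pre p q _ → separated pre p q _ ∘ grow)
    where
    open ≡-Reasoning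
    grow : ∀ {pre p post} → map P l ≡ pre ++ p ∷ post → map P (l ++ m) ≡ pre ++ p ∷ post ++ map P m
    grow {pre} {p} {post} eq = begin
      map P (l ++ m)               ≡⟨ map-++ P l m ⟩
      map P l ++ map P m           ≡⟨ cong (_++ map P m) eq ⟩
      (pre ++ p ∷ post) ++ map P m ≡⟨ ++-assoc pre (p ∷ post) (map P m) ⟩
      pre ++ p ∷ post ++ map P m   ∎

  proper-pair : ∀ {x y} → x ≢ y → Proper (x ∷ y ∷ [])
  proper-pair x≢y =
    ((x≢y ∷ []) ∷ [] ∷ [] , λ pre _ _ eq → ⊥-elim ∘ two-points pre eq) ,
    (λ pre _ _ eq → ⊥-elim ∘ two-points pre eq) ,
    (λ pre _ _ _ eq → ⊥-elim ∘ two-points′ pre eq)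
    where
    two-points : ∀ {a b p : Point} pre {post} → a ∷ b ∷ [] ≡ pre ++ p ∷ post → ¬ 2 ≤ length pre
    two-points (_ ∷ _ ∷ [])    ()
    two-points (_ ∷ _ ∷ _ ∷ _) ()
    two-points []              _ ()
    two-points (_ ∷ [])        _ (s≤s ())
    two-points′ : ∀ {a b p q : Point} pre {post} → a ∷ b ∷ [] ≡ pre ++ p ∷ q ∷ post → ¬ 1 ≤ length pre
    two-points′ (_ ∷ [])        ()
    two-points′ (_ ∷ _ ∷ [])    ()
    two-points′ (_ ∷ _ ∷ _ ∷ _) ()
    two-points′ []              _ ()

  proper-∷ʳ : ∀ {init z q} → Proper (init ∷ʳ z) → q ∉ init ∷ʳ z →
              PinFor (B (init ∷ʳ z)) (P q) → Maximal π (B (init ∷ʳ z)) (P q) →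
              StrictlyBetween (B init) (P z) (P q) → Proper (init ∷ʳ z ∷ʳ q)
  proper-∷ʳ {init} {z} {q} ((uniq , pins) , maximal , separated) q∉ pin max between =
    (Unique-∷ʳ uniq q∉ , pins′) , maximal′ , separated′
    where
    L = init ∷ʳ z
    split : ∀ {pre p} post → map P (L ∷ʳ q) ≡ pre ++ p ∷ post →
            (∃ λ post′ → map P L ≡ pre ++ p ∷ post′ × post ≡ post′ ∷ʳ P q) ⊎
            (map P L ≡ pre × p ≡ P q × post ≡ [])
    split {pre} post eq = ∷ʳ-≡-++-∷ (map P L) pre post (trans (sym (map-++ P L [ q ])) eq)

    pins′ : ∀ pre p post → map P (L ∷ʳ q) ≡ pre ++ p ∷ post → 2 ≤ length pre → PinFor (box pre) p
    pins′ pre p post eq with split post eq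
    ... | inj₁ (post′ , eq′ , _) = pins pre p post′ eq′
    ... | inj₂ (refl , refl , _) = λ _ → pin

    maximal′ : ∀ pre p post → map P (L ∷ʳ q) ≡ pre ++ p ∷ post → 2 ≤ length pre → Maximal π (box pre) p
    maximal′ pre p post eq with split post eq
    ... | inj₁ (post′ , eq′ , _) = maximal pre p post′ eq′
    ... | inj₂ (refl , refl , _) = λ _ → max

    separated′ : ∀ pre p q′ post → map P (L ∷ʳ q) ≡ pre ++ p ∷ q′ ∷ post → 1 ≤ length pre →
                 StrictlyBetween (box pre) p q′
    separated′ pre p q′ post eq with split (q′ ∷ post) eq
    ... | inj₁ (w ∷ post′ , eq′ , refl) = separated pre p q′ post′ eq′
    ... | inj₁ ([] , eq′ , refl)
      with ∷ʳ-injective (map P init) pre (trans (sym (map-++ P init [ z ])) eq′)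
    ...   | refl , refl = λ _ → between

  proper-∷ʳ-extreme : ∀ d x mid z q → let L = x ∷ mid ∷ʳ z in
    Proper L → InLane d (B L) (P q) → Extreme d (B L) (P q) → Beyond d (B L) (P q) →
    ¬ InLane d (B (x ∷ mid)) (P q) → Proper (L ∷ʳ q)
  proper-∷ʳ-extreme d x mid z q proper q∈lane extreme beyond fresh =
    proper-∷ʳ {x ∷ mid} proper q∉ (Beyond⇒PinFor d inside beyond)
              (Beyond⇒Maximal d x∈ q∈lane beyond extreme) between
    where
    x∈ : InRect (B (x ∷ mid ∷ʳ z)) (P x)
    x∈ = All.head (∈-B x (mid ∷ʳ z))
    q∉ : q ∉ x ∷ mid ∷ʳ z
    q∉ q∈ = Beyond⇒∉ d beyond (All.lookup (∈-B x (mid ∷ʳ z)) q∈)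
    inside : SpansStrictly (across d) (B (x ∷ mid ∷ʳ z)) (coord (across d) (P q))
    inside = Spans⇒SpansStrictly (across d) x (mid ∷ʳ z) q∉ q∈lane
    between : StrictlyBetween (B (x ∷ mid)) (P z) (P q)
    between = StrictlyBetween-⊔ᴿ-point (across d)
                (subst (λ R → SpansStrictly (across d) R _) (B-∷ʳ x mid z) inside) fresh

  closed⇒IsInterval : ∀ {a b c d} → a ≤ b → b < n → c ≤ d → d < n →
    (∀ i → toℕ i ∈[ a , b ] → toℕ (π ⟨$⟩ʳ i) ∈[ c , d ]) →
    (∀ i → toℕ (π ⟨$⟩ʳ i) ∈[ c , d ] → toℕ i ∈[ a , b ]) → IsInterval π a b
  closed⇒IsInterval {a} {b} {c} {d} a≤b b<n c≤d d<n cols⇒rows rows⇒cols =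
    c , λ y → (λ { (i , i∈ , refl) → subst (_ ∈[ c ,_]) (sym c+width≡d) (cols⇒rows i i∈) }) ,
              (λ y∈ → π ⟨$⟩ˡ y , rows⇒cols′ y (subst (_ ∈[ c ,_]) c+width≡d y∈) , inverseʳ π)
    where
    rows⇒cols′ : ∀ y → toℕ y ∈[ c , d ] → toℕ (π ⟨$⟩ˡ y) ∈[ a , b ]
    rows⇒cols′ y y∈ = rows⇒cols (π ⟨$⟩ˡ y) (subst (_∈[ c , d ]) (sym (cong toℕ (inverseʳ π))) y∈)
    c+width≡d : c + (b ∸ a) ≡ d
    c+width≡d = trans (cong (c +_) (≤-antisym
      (injection-span (π ⟨$⟩ʳ_) (Injection.injective (↔⇒↣ π)) a≤b b<n cols⇒rows)
      (injection-span (π ⟨$⟩ˡ_) (Injection.injective (↔⇒↣ (flip π))) c≤d d<n rows⇒cols′)))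
      (m+[n∸m]≡n c≤d)

-- Exploring the plot from p₁ and p₂

module Exploration {n} (π : Permutation′ n) (simple : Simple π) {p₁ p₂ : Fin n}
                   (p₁≢p₂ : p₁ ≢ p₂) (p₁-not-rightmost : suc (toℕ p₁) ≢ n) where

  open PinSequences π

  Goal : Set
  Goal = Σ (List (Fin n)) λ rest → Proper (p₁ ∷ p₂ ∷ rest) × RightReaching π (p₁ ∷ p₂ ∷ rest)

  record Seq : Set where
    constructor seq
    field
      rest   : List (Fin n)
      proper : Proper (p₁ ∷ p₂ ∷ rest)
  open Seq

  boxOf : Seq → Rect
  boxOf s = B (p₁ ∷ p₂ ∷ rest s)

  p₁∈boxOf : ∀ s → InRect (boxOf s) (P p₁)
  p₁∈boxOf s = All.head (∈-B p₁ (p₂ ∷ rest s))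

  p₂∈boxOf : ∀ s → InRect (boxOf s) (P p₂)
  p₂∈boxOf s = All.head (All.tail (∈-B p₁ (p₂ ∷ rest s)))

  module _ (s : Seq) {ys z zs} (split : p₂ ∷ rest s ≡ ys ++ z ∷ zs) where

    private
      s≡ : p₁ ∷ p₂ ∷ rest s ≡ (p₁ ∷ ys ∷ʳ z) ++ zs
      s≡ = cong (p₁ ∷_) (trans split (sym (++-assoc ys [ z ] zs)))

    prefix-proper : Proper (p₁ ∷ ys ∷ʳ z)
    prefix-proper = proper-++⁻ˡ (p₁ ∷ ys ∷ʳ z) (subst Proper s≡ (proper s))

    prefix-⊆ᴿ : B (p₁ ∷ ys ∷ʳ z) ⊆ᴿ boxOf s
    prefix-⊆ᴿ = subst (λ l → B (p₁ ∷ ys ∷ʳ z) ⊆ᴿ B l) (sym s≡) (B-++ p₁ (ys ∷ʳ z) zs)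

    prefix-∷ʳ : ∀ {q} → Proper (p₁ ∷ ys ∷ʳ z ∷ʳ q) → Σ Seq λ s′ → InRect (boxOf s′) (P q)
    prefix-∷ʳ {q} proper′ with ∷ʳ-head ys zs split
    ... | xs , ys∷ʳz≡ = seq (xs ∷ʳ q) (subst (λ l → Proper (p₁ ∷ l ∷ʳ q)) ys∷ʳz≡ proper′) ,
                        ∈-B-last p₁ (p₂ ∷ xs) q

    prefix-reaches : suc (toℕ z) ≡ n → Goal
    prefix-reaches z-rightmost with ∷ʳ-head ys zs split
    ... | xs , ys∷ʳz≡ = xs , subst (λ l → Proper (p₁ ∷ l)) ys∷ʳz≡ prefix-proper ,
                        p₁ ∷ ys , z , cong (p₁ ∷_) (sym ys∷ʳz≡) , z-rightmost

  LaneEscapes : Dir → Rect → List (Fin n) → Set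
  LaneEscapes d R l = ∃ λ i → InLane d (B l) (P i) × Beyond d R (P i)

  LaneEscapes? : ∀ d R l → Dec (LaneEscapes d R l)
  LaneEscapes? d R l = any? λ i → InLane? d (B l) (P i) ×-dec Beyond? d R (P i)

  ¬LaneEscapes-[_] : ∀ {d R} x → InRect R (P x) → ¬ LaneEscapes d R [ x ]
  ¬LaneEscapes-[_] {d} x x∈R (i , i∈ , beyond) with coord-injective (across d) (Spans-point (across d) i∈)
  ... | refl = Beyond⇒∉ d beyond x∈R

  push : ∀ d R (s : Seq) → InRect R (P p₁) → boxOf s ⊆ᴿ R → LaneEscapes d R (p₁ ∷ p₂ ∷ rest s) →
         Σ Seq λ s′ → ∃ λ q → InRect (boxOf s′) (P q) × Beyond d R (P q)
  push d R s p₁∈R s⊆R escapes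
    with shortest-prefix (LaneEscapes? d R ∘ (p₁ ∷_)) (p₂ ∷ rest s) (¬LaneEscapes-[ p₁ ] p₁∈R) escapes
  ... | mid , z , post , split , ¬escapes , (j , j∈ , j-beyond) with extreme d (B (p₁ ∷ mid ∷ʳ z)) j∈
  ... | q , q∈ , q-extreme = let s′ , q∈s′ = prefix-∷ʳ s split proper′ in s′ , q , q∈s′ , q-beyond
    where
    q-beyond : Beyond d R (P q)
    q-beyond = Beyond-¬Ahead d j-beyond (λ ahead → q-extreme j (ahead , j∈))
    proper′ : Proper (p₁ ∷ mid ∷ʳ z ∷ʳ q)
    proper′ = proper-∷ʳ-extreme d p₁ mid z q (prefix-proper s split) q∈ q-extreme
                (Beyond-⊆ᴿ d (⊆ᴿ-trans (prefix-⊆ᴿ s split) s⊆R) q-beyond)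
                (λ q∈mid → ¬escapes (q , q∈mid , q-beyond))

  -- Every box contains p₁, so the spans of the frame and of a new box overlap and together
  -- cover the span of their hull; this is what keeps cover valid in enlarge.
  record Region : Set where
    field
      frame    : Rect
      p₁∈frame : InRect frame (P p₁)
      cover    : ∀ a {v} → Spans a frame v → Σ Seq λ s → Spans a (boxOf s) v × boxOf s ⊆ᴿ frame
  open Region public

  initial : Region
  initial = record { frame = boxOf s₀ ; p₁∈frame = p₁∈boxOf s₀ ; cover = λ _ v∈ → s₀ , v∈ , ⊆ᴿ-refl }
    where s₀ = seq [] (proper-pair p₁≢p₂)

  enlarge : Region → Seq → Region
  enlarge G s = record
    { frame    = frame G ⊔ᴿ boxOf s
    ; p₁∈frame = InRect-⊆ᴿ (⊆ᴿ-⊔ᴿˡ (frame G) (boxOf s)) (p₁∈frame G)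
    ; cover    = cover′
    }
    where
    cover′ : ∀ a {v} → Spans a (frame G ⊔ᴿ boxOf s) v →
             Σ Seq λ s′ → Spans a (boxOf s′) v × boxOf s′ ⊆ᴿ frame G ⊔ᴿ boxOf s
    cover′ a v∈ with Spans-⊔ᴿ a (InRect⇒Spans a (p₁∈frame G)) (InRect⇒Spans a (p₁∈boxOf s)) v∈
    ... | inj₁ v∈G = let s′ , v∈s′ , s′⊆G = cover G a v∈G in
                     s′ , v∈s′ , ⊆ᴿ-trans s′⊆G (⊆ᴿ-⊔ᴿˡ (frame G) (boxOf s))
    ... | inj₂ v∈s = s , v∈s , ⊆ᴿ-⊔ᴿʳ (frame G) (boxOf s)

  cover-hi : ∀ G a → Σ Seq λ s → hi a (boxOf s) ≡ hi a (frame G)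
  cover-hi G a with cover G a (lo≤hi a (p₁∈frame G) , ≤-refl)
  ... | s , (_ , frame≤s) , s⊆G = s , ≤-antisym (hi-⊆ᴿ a s⊆G) frame≤s

  hi-frame<n : ∀ G a → hi a (frame G) < n
  hi-frame<n G a = let s , hi≡ = cover-hi G a in subst (_< n) hi≡ (hi-B<n a p₁ (p₂ ∷ rest s))

  size<2n : ∀ G → size (frame G) < n + n
  size<2n G = +-mono-< (extent<n horizontal) (extent<n vertical)
    where
    extent<n : ∀ a → extent a (frame G) < n
    extent<n a = ≤-<-trans (m∸n≤m (hi a (frame G)) (lo a (frame G))) (hi-frame<n G a)

  frame-wide : ∀ G → ra (frame G) < rb (frame G)
  frame-wide G with cover G horizontal (InRect⇒Spans horizontal (p₁∈frame G))
  ... | s , _ , (a , b , _) =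
    <-≤-trans (≤-<-trans a (lo<hi horizontal (p₁∈boxOf s) (p₂∈boxOf s) (p₁≢p₂ ∘ toℕ-injective))) b

  Escape : Rect → Set
  Escape R = ∃₂ λ d j → InLane d R (P j) × Beyond d R (P j)

  Escape? : ∀ R → Dec (Escape R)
  Escape? R = any-Dir? λ d → any? λ j → InLane? d R (P j) ×-dec Beyond? d R (P j)

  closed⇒interval : ∀ G → ¬ Escape (frame G) → IsInterval π (ra (frame G)) (rb (frame G))
  closed⇒interval G ¬escape =
    closed⇒IsInterval (<⇒≤ (frame-wide G)) (hi-frame<n G horizontal)
                      (lo≤hi vertical (p₁∈frame G)) (hi-frame<n G vertical) cols⇒rows rows⇒cols
    where
    R = frame G
    cols⇒rows : ∀ j → toℕ j ∈[ ra R , rb R ] → toℕ (π ⟨$⟩ʳ j) ∈[ rc R , rd R ]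
    cols⇒rows j j∈ = ≮⇒≥ (λ below → ¬escape (down , j , j∈ , below)) ,
                     ≮⇒≥ (λ above → ¬escape (up , j , j∈ , above))
    rows⇒cols : ∀ j → toℕ (π ⟨$⟩ʳ j) ∈[ rc R , rd R ] → toℕ j ∈[ ra R , rb R ]
    rows⇒cols j j∈ = ≮⇒≥ (λ to-left → ¬escape (left , j , j∈ , to-left)) ,
                     ≮⇒≥ (λ to-right → ¬escape (right , j , j∈ , to-right))

  frame-rightmost : ∀ G → suc (rb (frame G)) ≡ n → Goal
  frame-rightmost G rb+1≡n with cover-hi G horizontal
  ... | s , rb≡ with B-hi-attained horizontal p₁ (p₂ ∷ rest s)
  ...   | here p₁≡ = ⊥-elim (p₁-not-rightmost (trans (cong suc (trans p₁≡ rb≡)) rb+1≡n))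
  ...   | there attained with find attained
  ...     | r , r∈ , r≡ with ∈-∃++ r∈
  ...       | ys , zs , split = prefix-reaches s split (trans (cong suc (trans r≡ rb≡)) rb+1≡n)

  closed : ∀ G → ¬ Escape (frame G) → Goal
  closed G ¬escape =
    Sum.[ (λ ra≡rb → ⊥-elim (<-irrefl ra≡rb (frame-wide G))) , (λ (_ , rb+1≡n) → frame-rightmost G rb+1≡n) ]′
      (simple (ra (frame G)) (rb (frame G)) (<⇒≤ (frame-wide G)) (hi-frame<n G horizontal)
              (closed⇒interval G ¬escape))

  grow : ∀ G → Escape (frame G) → Σ Seq λ s → size (frame G) < size (frame (enlarge G s))
  grow G (d , j , j∈ , beyond) =
    let s , j∈s , s⊆G = cover G (across d) j∈
        s′ , q , q∈s′ , q-beyond = push d (frame G) s (p₁∈frame G) s⊆G (j , j∈s , beyond)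
    in s′ , size-⊔ᴿ-grows d (p₁∈frame G) q∈s′ q-beyond

  explore : ∀ fuel G → n + n ≤ size (frame G) + fuel → Goal
  explore zero G enough = ⊥-elim (<⇒≱ (size<2n G) (subst (n + n ≤_) (+-identityʳ _) enough))
  explore (suc fuel) G enough = case Escape? (frame G) of λ where
    (no ¬escape) → closed G ¬escape
    (yes escape) → let s , grows = grow G escape in
      explore fuel (enlarge G s) (≤-trans enough (≤-trans (≤-reflexive (+-suc _ fuel)) (+-monoˡ-≤ fuel grows)))

lemma3p6 : (n : ℕ) (π : Permutation′ n) → Simple π →
    (p₁ p₂ : Fin n) → p₁ ≢ p₂ → suc (toℕ p₁) ≢ n →
    Σ (List (Fin n)) λ rest →
      ProperPinSequence π (p₁ ∷ p₂ ∷ rest) × RightReaching π (p₁ ∷ p₂ ∷ rest)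
lemma3p6 n π simple p₁ p₂ p₁≢p₂ p₁-not-rightmost =
  explore (n + n) initial (m≤n+m (n + n) (size (frame initial)))
  where open Exploration π simple p₁≢p₂ p₁-not-rightmost
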